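{- (d'Ocagne's identity.) For all integers $n, m \ge 0$, \[ Q^P_m\,Q^P_{n+1} - Q^P_{m+1}\,Q^P_n = (-1)^n\, 2\,P_{m-n}\,(1 + i + 6\varepsilon + 6\,i\varepsilon). \]
   Context: Dual-complex numbers are expressions $x_1 + i\,x_2 + \varepsilon\,y_1 + i\varepsilon\,y_2$ with real coefficients, forming a commutative associative real algebra with basis $\{1,i,\varepsilon,i\varepsilon\}$, where $i^2=-1$, $\varepsilon\ne 0$, $\varepsilon^2=0$, $i\varepsilon=\varepsilon i$, $(i\varepsilon)^2=0$. Pell numbers: $P_0=0$, $P_1=1$, $P_n=2P_{n-1}+P_{n-2}$, extended to negative indices by the same recurrence, i.e. $P_{ -k}=(-1)^{k+1}P_k$. The dual-complex Pell quaternion is $Q^P_n = P_n + i\,P_{n+1} + \varepsilon\,P_{n+2} + i\varepsilon\,P_{n+3}$, with products taken in the dual-complex algebra. -}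

module Defs where

open import Data.Nat as ℕ using (ℕ; zero; suc)
open import Data.Integer using (ℤ; +_; -[1+_]; _+_; _*_; -_; _-_)

pellℕ : ℕ → ℤ
pellℕ zero = + 0
pellℕ (suc zero) = + 1
pellℕ (suc (suc n)) = + 2 * pellℕ (suc n) + pellℕ n

sgn : ℕ → ℤ
sgn zero = + 1
sgn (suc k) = - sgn k

-- Pell numbers on all integer indices, extended backwards by the same
-- recurrence, i.e. P (-k) = (-1)^(k+1) P k
pell : ℤ → ℤ
pell (+ n) = pellℕ n
pell -[1+ k ] = sgn (suc (suc k)) * pellℕ (suc k)

-- Dual-complex numbers x1 + i x2 + ε y1 + iε y2 with integer coefficients
-- (Pell numbers are integers, so ℤ coefficients suffice; the algebra
-- operations are given by the same formulas as over ℝ).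
record DC : Set where
  constructor dc
  field
    re  : ℤ
    im  : ℤ
    ep  : ℤ
    iep : ℤ

infixl 6 _⊕_ _⊖_
infixl 7 _⊗_

_⊕_ : DC → DC → DC
dc a b c d ⊕ dc a' b' c' d' = dc (a + a') (b + b') (c + c') (d + d')

_⊖_ : DC → DC → DC
dc a b c d ⊖ dc a' b' c' d' = dc (a - a') (b - b') (c - c') (d - d')

-- product in the algebra with i² = -1, ε² = 0, iε = εi
_⊗_ : DC → DC → DC
dc a b c d ⊗ dc a' b' c' d' =
  dc (a * a' - b * b')
     (a * b' + b * a')
     (a * c' - b * d' + c * a' - d * b')
     (a * d' + b * c' + c * b' + d * a')

scale : ℤ → DC → DC
scale k (dc a b c d) = dc (k * a) (k * b) (k * c) (k * d)

QP : ℤ → DC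
QP n = dc (pell n) (pell (n + + 1)) (pell (n + + 2)) (pell (n + + 3))

{-# OPTIONS --safe #-}
-- The Pell recurrence expresses each Q^P_k through the two consecutive Pell numbers
-- P_k, P_{k+1}; with these as indeterminates the left-hand side becomes, by a direct
-- polynomial computation, 2 (P_m P_{n+1} - P_{m+1} P_n) (1 + i + 6ε + 6iε).  The scalar
-- factor is the d'Ocagne identity for Pell numbers, P_m P_{n+1} - P_{m+1} P_n =
-- (-1)^n P_{m-n}, proved by induction on n and m: shifting both indices by one
-- negates the left-hand side.
module Submission where

open import Defs
open import Data.Nat using (ℕ; zero; suc; z≤n)
import Data.Nat.Properties as ℕₚ
open import Data.Integer using (ℤ; +_; _+_; _-_; _*_; -_) renaming (_⊖_ to _⊝_)
import Data.Integer.Properties as ℤ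
open import Data.Integer.Tactic.RingSolver using (solve-∀)
open import Relation.Binary.PropositionalEquality

pellStep : ℤ → ℤ → ℤ
pellStep a b = + 2 * b + a

pellQuaternion : ℤ → ℤ → DC
pellQuaternion a b = dc a b c (pellStep b c)
  where c = pellStep a b

QP-pellQuaternion : ∀ m → QP (+ m) ≡ pellQuaternion (pellℕ m) (pellℕ (suc m))
QP-pellQuaternion m rewrite ℕₚ.+-comm m 1 | ℕₚ.+-comm m 2 | ℕₚ.+-comm m 3 = refl

QP-suc-pellQuaternion : ∀ m →
  QP (+ m + + 1) ≡ pellQuaternion (pellℕ (suc m)) (pellℕ (suc (suc m)))
QP-suc-pellQuaternion m rewrite ℕₚ.+-comm m 1 = QP-pellQuaternion (suc m)

sgn-*-sgn : ∀ k → sgn k * sgn k ≡ + 1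
sgn-*-sgn zero = refl
sgn-*-sgn (suc k) = trans (neg-*-neg (sgn k)) (sgn-*-sgn k)
  where
  neg-*-neg : ∀ x → (- x) * (- x) ≡ x * x
  neg-*-neg = solve-∀

pellℕ-dOcagne : ∀ n m →
  pellℕ m * pellℕ (suc n) - pellℕ (suc m) * pellℕ n ≡ sgn n * pell (m ⊝ n)
pellℕ-dOcagne zero m = begin
  pellℕ m * + 1 - pellℕ (suc m) * + 0 ≡⟨ drop-zero (pellℕ m) (pellℕ (suc m)) ⟩
  + 1 * pell (+ m)                     ≡⟨ cong (λ k → + 1 * pell k) (ℤ.⊖-≥ {m} {0} z≤n) ⟨
  + 1 * pell (m ⊝ 0)                   ∎
  where
  open ≡-Reasoning
  drop-zero : ∀ x y → x * + 1 - y * + 0 ≡ + 1 * x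
  drop-zero = solve-∀
-- Here 0 ⊝ suc n is -[1+ n ], and pell -[1+ n ] unfolds to sgn (2 + n) * P_{n+1}.
pellℕ-dOcagne (suc n) zero = begin
  + 0 * pellStep q p - + 1 * p ≡⟨ negate p q ⟩
  - (+ 1 * p)                  ≡⟨ cong (λ s → - (s * p)) (sgn-*-sgn n) ⟨
  - (sgn n * sgn n * p)        ≡⟨ regroup (sgn n) p ⟩
  (- sgn n) * (- - sgn n * p)  ∎
  where
  open ≡-Reasoning
  p = pellℕ (suc n)
  q = pellℕ n
  negate : ∀ p q → + 0 * (+ 2 * p + q) - + 1 * p ≡ - (+ 1 * p)
  negate = solve-∀
  regroup : ∀ s p → - (s * s * p) ≡ (- s) * (- - s * p)
  regroup = solve-∀
pellℕ-dOcagne (suc n) (suc m) = begin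
  b * pellStep c e - pellStep a b * e ≡⟨ shiftNegates a b c e ⟩
  - (a * e - b * c)                   ≡⟨ cong -_ (pellℕ-dOcagne n m) ⟩
  - (sgn n * pell (m ⊝ n))            ≡⟨ ℤ.neg-distribˡ-* (sgn n) (pell (m ⊝ n)) ⟩
  - sgn n * pell (m ⊝ n)              ≡⟨ cong (λ k → - sgn n * pell k) (ℤ.[1+m]⊖[1+n]≡m⊖n m n) ⟨
  - sgn n * pell (suc m ⊝ suc n)      ∎
  where
  open ≡-Reasoning
  a = pellℕ m
  b = pellℕ (suc m)
  c = pellℕ n
  e = pellℕ (suc n)
  shiftNegates : ∀ a b c e → b * (+ 2 * e + c) - (+ 2 * b + a) * e ≡ - (a * e - b * c)
  shiftNegates = solve-∀

pellQuaternion-dOcagne : ∀ a b c e →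
  pellQuaternion a b ⊗ pellQuaternion e (pellStep c e)
    ⊖ pellQuaternion b (pellStep a b) ⊗ pellQuaternion c e
  ≡ scale (+ 2 * (a * e - b * c)) (dc (+ 1) (+ 1) (+ 6) (+ 6))
pellQuaternion-dOcagne a b c e = cong₄ (re a b c e) (im a b c e) (ep a b c e) (iep a b c e)
  where
  cong₄ : ∀ {x y z w x′ y′ z′ w′} →
    x ≡ x′ → y ≡ y′ → z ≡ z′ → w ≡ w′ → dc x y z w ≡ dc x′ y′ z′ w′
  cong₄ refl refl refl refl = refl
  re : ∀ a b c e →
    (a * e - b * (+ 2 * e + c))
      - (b * c - (+ 2 * b + a) * e)
    ≡ + 2 * (a * e - b * c) * + 1
  re = solve-∀
  im : ∀ a b c e →
    (a * (+ 2 * e + c) + b * e)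
      - (b * e + (+ 2 * b + a) * c)
    ≡ + 2 * (a * e - b * c) * + 1
  im = solve-∀
  ep : ∀ a b c e →
    (a * (+ 2 * (+ 2 * e + c) + e) - b * (+ 2 * (+ 2 * (+ 2 * e + c) + e) + (+ 2 * e + c)) + (+ 2 * b + a) * e - (+ 2 * (+ 2 * b + a) + b) * (+ 2 * e + c))
      - (b * (+ 2 * e + c) - (+ 2 * b + a) * (+ 2 * (+ 2 * e + c) + e) + (+ 2 * (+ 2 * b + a) + b) * c - (+ 2 * (+ 2 * (+ 2 * b + a) + b) + (+ 2 * b + a)) * e)
    ≡ + 2 * (a * e - b * c) * + 6
  ep = solve-∀
  iep : ∀ a b c e →
    (a * (+ 2 * (+ 2 * (+ 2 * e + c) + e) + (+ 2 * e + c)) + b * (+ 2 * (+ 2 * e + c) + e) + (+ 2 * b + a) * (+ 2 * e + c) + (+ 2 * (+ 2 * b + a) + b) * e)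
      - (b * (+ 2 * (+ 2 * e + c) + e) + (+ 2 * b + a) * (+ 2 * e + c) + (+ 2 * (+ 2 * b + a) + b) * e + (+ 2 * (+ 2 * (+ 2 * b + a) + b) + (+ 2 * b + a)) * c)
    ≡ + 2 * (a * e - b * c) * + 6
  iep = solve-∀

theorem3p3 : (n m : ℕ) →
    QP (+ m) ⊗ QP (+ n Data.Integer.+ + 1) ⊖ QP (+ m Data.Integer.+ + 1) ⊗ QP (+ n)
      ≡ scale (sgn n * + 2 * pell (+ m - + n)) (dc (+ 1) (+ 1) (+ 6) (+ 6))
theorem3p3 n m = begin
  QP (+ m) ⊗ QP (+ n + + 1) ⊖ QP (+ m + + 1) ⊗ QP (+ n)
    ≡⟨ cong₂ _⊖_ (cong₂ _⊗_ (QP-pellQuaternion m) (QP-suc-pellQuaternion n))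
                 (cong₂ _⊗_ (QP-suc-pellQuaternion m) (QP-pellQuaternion n)) ⟩
  pellQuaternion a b ⊗ pellQuaternion e (pellStep c e)
    ⊖ pellQuaternion b (pellStep a b) ⊗ pellQuaternion c e
    ≡⟨ pellQuaternion-dOcagne a b c e ⟩
  scale (+ 2 * (a * e - b * c)) ω
    ≡⟨ cong (λ k → scale (+ 2 * k) ω) (pellℕ-dOcagne n m) ⟩
  scale (+ 2 * (sgn n * pell (m ⊝ n))) ω
    ≡⟨ cong (λ k → scale k ω) (reassoc (sgn n) (pell (m ⊝ n))) ⟩
  scale (sgn n * + 2 * pell (m ⊝ n)) ω
    ≡⟨ cong (λ k → scale (sgn n * + 2 * pell k) ω) (ℤ.m-n≡m⊖n m n) ⟨
  scale (sgn n * + 2 * pell (+ m - + n)) ω ∎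
  where
  open ≡-Reasoning
  a = pellℕ m
  b = pellℕ (suc m)
  c = pellℕ n
  e = pellℕ (suc n)
  ω = dc (+ 1) (+ 1) (+ 6) (+ 6)
  reassoc : ∀ s x → + 2 * (s * x) ≡ s * + 2 * x
  reassoc = solve-∀
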